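{- Let $P$ be a finite poset with minimum $\hat0$, let $\rho:P\to\mathbb N$ and $m\in\mathbb N$ with $\max_{x\in P}\rho(x)\le m$. Let $(A_1,\dots,A_n)$ be an ordered partition of the atom set $A(P)$ and let $f:\prod_{i=1}^nRT_{\hat U(A_i)}\to P$ be a complete transversal function. Suppose: (1) if $\mathbf t\in\mathcal T_x^a$, then $|\operatorname{supp}\mathbf t|=\rho(x)$; (2) for every nonzero $x\in P$ there is an index $i$ with $|A_i\cap A_x|=1$. Then: (a) $P\cong\left(\prod_{i=1}^nRT_{\hat U(A_i)}\right)/\ker f$; (b) for each $x\in P$, $\mu(x)=(-1)^{\rho(x)}|\mathcal T_x^a|$; (c) $\chi(P,t)=t^{m-n}\prod_{i=1}^n(t-|A_i|)$.
   Context: All posets are finite with minimum $\hat0$; $\mu(x)$ is the Möbius function ($\sum_{y\le x}\mu(y)=\delta_{\hat0,x}$), and $\chi(P,t)=\sum_{x\in P}\mu(x)t^{m-\rho(x)}$ is the characteristic polynomial with respect to $\rho$ and $m$. $A_x$ is the set of atoms of $P$ below $x$. For $S\subseteq P$ containing $\hat0$, $RT_S$ is the poset of saturated chains of $P$ starting at $\hat0$ using only elements of $S$, ordered by containment; elements are identified with the top element of the chain. $\hat U(A)$ is the upper order ideal generated by a set of atoms $A$, together with $\hat0$. The product of rooted trees is ordered componentwise, elements $\mathbf t=(t_1,\dots,t_n)$. A complete transversal function is an order-preserving $f:\prod_iRT_{\hat U(A_i)}\to P$ such that if each $t_i$ is $\hat0$ or (has top element) $x$, then $f(\mathbf t)=x$.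 $\ker f$ is the equivalence $\mathbf s\sim\mathbf t\iff f(\mathbf s)=f(\mathbf t)$; $\mathcal T_x=f^{ -1}(x)$; $\mathbf t$ is atomic if each $t_i$ is $\hat0$ or an atom of $RT_{\hat U(A_i)}$; $\mathcal T_x^a$ is the set of atomic elements of $\mathcal T_x$; $\operatorname{supp}\mathbf t=\{i:t_i\neq\hat0\}$. For an equivalence relation $\sim$ on a poset $Q$, $Q/\sim$ is the set of classes with $X\le Y$ iff $x\le y$ for some $x\in X,y\in Y$. -}

module Defs where

open import Data.Nat using (ℕ; zero; suc; _+_; _≤ᵇ_; _<ᵇ_)
open import Data.Fin using (Fin; zero; suc)
open import Data.Fin.Properties using () renaming (_≟_ to _≟ᶠ_)
open import Data.Bool using (Bool; true; false; T; _∧_; _∨_; not; if_then_else_)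
open import Data.List using (List; []; _∷_; length; allFin)
open import Data.Bool.ListAction using (all; any)
open import Data.List.Membership.Propositional using (_∈_)
open import Data.Vec using (Vec; lookup)
open import Data.Product using (Σ; ∃; _×_)
open import Data.Sum using (_⊎_)
open import Data.Integer using (ℤ; +_; -_; _*_; _-_) renaming (_+_ to _+ℤ_; _^_ to _^ℤ_)
open import Relation.Binary.PropositionalEquality using (_≡_; _≢_)
open import Relation.Nullary.Decidable using (⌊_⌋)
open import Function.Bundles using (_↔_; _⇔_)

countᶠ : ∀ {k} → (Fin k → Bool) → ℕ
countᶠ {zero}  p = 0
countᶠ {suc k} p = (if p zero then 1 else 0) + countᶠ (λ i → p (suc i))

allᶠ : ∀ {k} → (Fin k → Bool) → Bool
allᶠ {zero}  p = true
allᶠ {suc k} p = p zero ∧ allᶠ (λ i → p (suc i))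

sumℤᶠ : ∀ {k} → (Fin k → ℤ) → ℤ
sumℤᶠ {zero}  g = + 0
sumℤᶠ {suc k} g = g zero +ℤ sumℤᶠ (λ i → g (suc i))

prodℤᶠ : ∀ {k} → (Fin k → ℤ) → ℤ
prodℤᶠ {zero}  g = + 1
prodℤᶠ {suc k} g = g zero * prodℤᶠ (λ i → g (suc i))

_HasSize_ : Set → ℕ → Set
A HasSize k = Fin k ↔ A

record FinPoset : Set where
  field
    N          : ℕ
    le         : Fin N → Fin N → Bool
    le-refl    : ∀ x → T (le x x)
    le-antisym : ∀ x y → T (le x y) → T (le y x) → x ≡ y
    le-trans   : ∀ x y z → T (le x y) → T (le y z) → T (le x z)
    bot        : Fin N
    bot-min    : ∀ x → T (le bot x)

Elt : FinPoset → Set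
Elt P = Fin (FinPoset.N P)

module _ (P : FinPoset) where
  open FinPoset P

  eqb : Fin N → Fin N → Bool
  eqb x y = ⌊ x ≟ᶠ y ⌋

  lt : Fin N → Fin N → Bool
  lt x y = le x y ∧ not (eqb x y)

  covers : Fin N → Fin N → Bool
  covers x y = lt x y ∧ all (λ z → not (lt x z ∧ lt z y)) (allFin N)

  isAtom : Fin N → Bool
  isAtom a = covers bot a

  module _ (n : ℕ) (blk : Fin N → Fin n) where
    inA : Fin n → Fin N → Bool
    inA i a = isAtom a ∧ ⌊ blk a ≟ᶠ i ⌋

    inU : Fin n → Fin N → Bool
    inU i y = eqb y bot ∨ any (λ a → inA i a ∧ le a y) (allFin N)

    -- saturated chains 0̂ = x₀ ⋖ x₁ ⋖ … ⋖ x_k inside Û(A_i),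
    -- represented bottom-up as the list [x₀, …, x_k]
    chainSteps : Fin n → Fin N → List (Fin N) → Bool
    chainSteps i x []       = true
    chainSteps i x (y ∷ ys) = covers x y ∧ inU i y ∧ chainSteps i y ys

    isChain : Fin n → List (Fin N) → Bool
    isChain i []       = false
    isChain i (x ∷ xs) = eqb x bot ∧ chainSteps i x xs

    top : List (Fin N) → Fin N
    top []           = bot
    top (x ∷ [])     = x
    top (x ∷ y ∷ ys) = top (y ∷ ys)

    validTuple : Vec (List (Fin N)) n → Bool
    validTuple v = allᶠ (λ i → isChain i (lookup v i))

    Tuple : Set
    Tuple = Σ (Vec (List (Fin N)) n) (λ v → T (validTuple v))

    comp : Tuple → Fin n → List (Fin N)
    comp t i = lookup (Data.Product.proj₁ t) i

    _≤T_ : Tuple → Tuple → Set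
    s ≤T t = ∀ i y → y ∈ comp s i → y ∈ comp t i

    -- t is atomic: every component is 0̂ (chain [0̂]) or an atom of
    -- RT_{Û(A_i)} (a chain [0̂, a]), i.e. has length ≤ 2
    atomic : Tuple → Bool
    atomic t = allᶠ (λ i → length (comp t i) ≤ᵇ 2)

    -- |supp t| = number of components different from 0̂
    suppSize : Tuple → ℕ
    suppSize t = countᶠ (λ i → 1 <ᵇ length (comp t i))

    -- (A_1,…,A_n) is an ordered partition of the atom set
    -- (blocks are nonempty; blk is irrelevant on non-atoms)
    IsOrderedPartition : Set
    IsOrderedPartition = ∀ i → ∃ (λ a → T (inA i a))

    blockSize : Fin n → ℕ
    blockSize i = countᶠ (inA i)

    IsCompleteTransversal : (Tuple → Fin N) → Set
    IsCompleteTransversal f =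
      (∀ s t → s ≤T t → T (le (f s) (f t))) ×
      (∀ t x → (∀ i → top (comp t i) ≡ bot ⊎ top (comp t i) ≡ x)
             → (x ≡ bot ⊎ ∃ (λ i → top (comp t i) ≡ x))
             → f t ≡ x)

    AtomicFiber : (Tuple → Fin N) → Fin N → Set
    AtomicFiber f x = Σ Tuple (λ t → T (atomic t) × f t ≡ x)

    -- (∏ RT)/ker f ≅ P, expressed via a map g : ∏ RT → P that is
    -- constant exactly on ker f-classes, surjective, and such that
    -- g s ≤ g t iff some s' ~ s, t' ~ t satisfy s' ≤ t'.
    QuotientIso : (Tuple → Fin N) → Set
    QuotientIso f = Σ (Tuple → Fin N) (λ g →
      (∀ s t → (f s ≡ f t) ⇔ (g s ≡ g t)) ×
      (∀ x → ∃ (λ t → g t ≡ x)) ×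
      (∀ s t → T (le (g s) (g t)) ⇔
                 ∃ (λ s′ → ∃ (λ t′ → f s′ ≡ f s × f t′ ≡ f t × s′ ≤T t′))))

  IsMobius : (Fin N → ℤ) → Set
  IsMobius μ = ∀ x →
    sumℤᶠ (λ y → if le y x then μ y else + 0) ≡ (if eqb x bot then + 1 else + 0)

  charPoly : (Fin N → ℤ) → (Fin N → ℕ) → ℕ → ℤ → ℤ
  charPoly μ ρ m t = sumℤᶠ (λ x → μ x * (t ^ℤ (m Data.Nat.∸ ρ x)))

module Submission where

-- Encode the atomic tuples by choice vectors v (an atom of A_i or nothing in each coordinate) and
-- put ν(x) = Σ_{f(v) = x} ∏_i w_i(v_i), with weight −1 for a chosen atom and 1 for no atom.  Every
-- element above an atom a ∈ A_i is the top of a saturated chain of Û(A_i) through a, so by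
-- monotonicity and completeness f(v) ≤ x exactly when all chosen atoms lie below x.  Summing over
-- y ≤ x therefore factorises: Σ_{y ≤ x} ν(y) = ∏_i (1 − |A_i ∩ A_x|), which is δ(0̂, x) by (2), so
-- ν = μ.  By (1) each nonzero term of ν(x) is (−1)^ρ(x), which is (b); the same factorisation with
-- weight t for "no atom" yields (c).  For (a), f itself is the quotient map, since comparable
-- elements are the tops of nested chains through a common atom.

open import Defs
open import Data.Nat using (ℕ; _≤_; _∸_)
open import Data.Fin using (Fin)
open import Data.Bool using (T)
open import Data.Product using (Σ; ∃; _×_)
open import Data.Integer using (ℤ; +_; -_; _*_; _-_; _^_)
open import Relation.Binary.PropositionalEquality using (_≡_; _≢_)

import Data.Nat as ℕ
import Data.Nat.Properties as ℕP
open import Data.Nat.Induction using (<-wellFounded)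
open import Data.Integer using (_+_)
import Data.Integer.Properties as ℤP
open import Data.Integer.Tactic.RingSolver using (solve-∀)
open import Data.Fin using (zero; suc)
import Data.Fin.Properties as FinP
open import Data.Bool using (Bool; true; false; _∧_; not; if_then_else_)
open import Data.Bool.Properties using (T-∧; T-∨; T-≡; ⇔→≡; T-irrelevant)
open import Data.Bool.ListAction using (all; any)
open import Data.Empty using (⊥-elim)
open import Data.Unit using (tt)
open import Data.Product using (_,_; proj₁; proj₂)
open import Data.Product.Properties using (Σ-≡,≡→≡)
open import Data.Product.Function.Dependent.Propositional using (Σ-↔)
open import Data.Sum using (_⊎_; inj₁; inj₂; map₂)
open import Data.Sum.Function.Propositional using (_⊎-↔_)
open import Data.List using (List; []; _∷_; _++_; length; allFin)
import Data.List.Relation.Unary.All as All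
import Data.List.Relation.Unary.All.Properties as AllP

import Data.List.Relation.Unary.Any.Properties as AnyP
open import Data.List.Relation.Unary.Any using (here; there; satisfied)
open import Data.List.Membership.Propositional using (_∈_; lose)
open import Data.List.Membership.Propositional.Properties using (∈-allFin)
open import Data.List.Relation.Binary.Subset.Propositional using (_⊆_)
open import Data.List.Relation.Binary.Subset.Propositional.Properties using (⊆-refl; ⊆-reflexive; xs⊆xs++ys)
open import Data.Vec using (Vec; []; _∷_; lookup; tabulate)
open import Data.Vec.Properties using (lookup∘tabulate; tabulate-cong; tabulate∘lookup)
open import Function.Base using (_∘_; id)
open import Function.Bundles using (_↔_; mk↔ₛ′; Equivalence; mk⇔)
open import Function.Properties.Inverse using (↔-refl; ↔-trans)
open import Relation.Binary.PropositionalEquality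
  using (refl; sym; trans; cong; cong₂; subst; subst₂; module ≡-Reasoning)
open import Relation.Binary.Construct.On as On using ()
open import Relation.Nullary using (¬_; yes; no)
open import Relation.Nullary.Decidable using (⌊_⌋; toWitness; fromWitness; T?)
open import Induction.WellFounded using (WellFounded; Acc; acc; module Subrelation)
open import Axiom.UniquenessOfIdentityProofs using (module Decidable⇒UIP)

open import Algebra.Properties.Semiring.Sum ℤP.+-*-semiring
  using (sum; sum-cong-≗; sum-replicate-zero; ∑-distrib-+; ∑-comm; *-distribˡ-sum; *-distribʳ-sum)
open import Algebra.Properties.CommutativeMonoid.Sum ℤP.*-1-commutativeMonoid
  using () renaming (sum to prod; sum-cong-≗ to prod-cong-≗; ∑-distrib-+ to prod-distrib-*;
                     sum-replicate-zero to prod-replicate-one)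
open import Algebra.Properties.CommutativeMonoid.Sum ℕP.+-0-commutativeMonoid
  using () renaming (sum to sumℕ)
open import Algebra.Properties.AbelianGroup ℤP.+-0-abelianGroup using (∙-cancelʳ)

open Equivalence using (to; from)

T-not⇒¬T : ∀ {b} → T (not b) → ¬ T b
T-not⇒¬T {false} _ ()

¬T⇒T-not : ∀ {b} → ¬ T b → T (not b)
¬T⇒T-not {true}  ¬b = ¬b tt
¬T⇒T-not {false} _  = tt

if-false : ∀ {A : Set} {b} {x y : A} → ¬ T b → (if b then x else y) ≡ y
if-false {b = true}  ¬b = ⊥-elim (¬b tt)
if-false {b = false} _  = refl

allᶠ-intro : ∀ {k} (p : Fin k → Bool) → (∀ i → T (p i)) → T (allᶠ p)
allᶠ-intro {ℕ.zero}  p all-p = tt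
allᶠ-intro {ℕ.suc k} p all-p = from (T-∧ {p zero}) (all-p zero , allᶠ-intro (p ∘ suc) (all-p ∘ suc))

allᶠ-elim : ∀ {k} (p : Fin k → Bool) → T (allᶠ p) → ∀ i → T (p i)
allᶠ-elim {ℕ.suc k} p all-p zero    = proj₁ (to (T-∧ {p zero}) all-p)
allᶠ-elim {ℕ.suc k} p all-p (suc i) = allᶠ-elim (p ∘ suc) (proj₂ (to (T-∧ {p zero}) all-p)) i

count-cong : ∀ {k} {p q : Fin k → Bool} → (∀ i → p i ≡ q i) → countᶠ p ≡ countᶠ q
count-cong {ℕ.zero}  p≗q = refl
count-cong {ℕ.suc k} p≗q = cong₂ ℕ._+_ (cong (λ b → if b then 1 else 0) (p≗q zero)) (count-cong (p≗q ∘ suc))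

count-zero : ∀ {k} (p : Fin k → Bool) → (∀ i → ¬ T (p i)) → countᶠ p ≡ 0
count-zero {ℕ.zero}  p none = refl
count-zero {ℕ.suc k} p none with p zero in p₀
... | true  = ⊥-elim (none zero (from T-≡ p₀))
... | false = count-zero (p ∘ suc) (none ∘ suc)

count-complement : ∀ {k} (p : Fin k → Bool) → countᶠ p ℕ.+ countᶠ (not ∘ p) ≡ k
count-complement {ℕ.zero}  p = refl
count-complement {ℕ.suc k} p with p zero
... | true  = cong ℕ.suc (count-complement (p ∘ suc))
... | false = trans (ℕP.+-suc _ _) (cong ℕ.suc (count-complement (p ∘ suc)))

count-mono : ∀ {k} (p q : Fin k → Bool) → (∀ i → T (p i) → T (q i)) → countᶠ p ℕ.≤ countᶠ q
count-mono {ℕ.zero}  p q p⇒q = ℕ.z≤n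
count-mono {ℕ.suc k} p q p⇒q with p zero in ep | q zero in eq
... | true  | true  = ℕ.s≤s (count-mono (p ∘ suc) (q ∘ suc) (p⇒q ∘ suc))
... | true  | false = ⊥-elim (subst T eq (p⇒q zero (from T-≡ ep)))
... | false | true  = ℕP.m≤n⇒m≤1+n (count-mono (p ∘ suc) (q ∘ suc) (p⇒q ∘ suc))
... | false | false = count-mono (p ∘ suc) (q ∘ suc) (p⇒q ∘ suc)

count-strict : ∀ {k} (p q : Fin k → Bool) → (∀ i → T (p i) → T (q i)) →
  ∀ w → T (q w) → ¬ T (p w) → countᶠ p ℕ.< countᶠ q
count-strict {ℕ.suc k} p q p⇒q zero qw ¬pw with p zero in ep | q zero in eq
... | true  | _     = ⊥-elim (¬pw tt)
... | false | false = ⊥-elim qw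
... | false | true  = ℕ.s≤s (count-mono (p ∘ suc) (q ∘ suc) (p⇒q ∘ suc))
count-strict {ℕ.suc k} p q p⇒q (suc w) qw ¬pw with p zero in ep | q zero in eq
... | true  | true  = ℕ.s≤s (count-strict (p ∘ suc) (q ∘ suc) (p⇒q ∘ suc) w qw ¬pw)
... | true  | false = ⊥-elim (subst T eq (p⇒q zero (from T-≡ ep)))
... | false | true  = ℕP.m≤n⇒m≤1+n (count-strict (p ∘ suc) (q ∘ suc) (p⇒q ∘ suc) w qw ¬pw)
... | false | false = count-strict (p ∘ suc) (q ∘ suc) (p⇒q ∘ suc) w qw ¬pw

m∸s≡[m∸n]+s′ : ∀ {m n s s′} → s ℕ.+ s′ ≡ n → n ℕ.≤ m → m ∸ s ≡ (m ∸ n) ℕ.+ s′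
m∸s≡[m∸n]+s′ {m} {n} {s} {s′} refl n≤m = begin
  m ∸ s                          ≡⟨ cong (_∸ s) (ℕP.m∸n+n≡m n≤m) ⟨
  (m ∸ n) ℕ.+ (s ℕ.+ s′) ∸ s     ≡⟨ ℕP.+-∸-assoc (m ∸ n) (ℕP.m≤m+n s s′) ⟩
  (m ∸ n) ℕ.+ (s ℕ.+ s′ ∸ s)     ≡⟨ cong ((m ∸ n) ℕ.+_) (ℕP.m+n∸m≡n s s′) ⟩
  (m ∸ n) ℕ.+ s′                 ∎
  where open ≡-Reasoning

[_]ℤ : Bool → ℤ
[ b ]ℤ = if b then + 1 else + 0

if-then-0 : ∀ b x → (if b then x else + 0) ≡ x * [ b ]ℤ
if-then-0 true  x = sym (ℤP.*-identityʳ x)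
if-then-0 false x = sym (ℤP.*-zeroʳ x)

sumℤᶠ≡sum : ∀ {k} (g : Fin k → ℤ) → sumℤᶠ g ≡ sum g
sumℤᶠ≡sum {ℕ.zero}  g = refl
sumℤᶠ≡sum {ℕ.suc k} g = cong (_+_ (g zero)) (sumℤᶠ≡sum (g ∘ suc))

prodℤᶠ≡prod : ∀ {k} (g : Fin k → ℤ) → prodℤᶠ g ≡ prod g
prodℤᶠ≡prod {ℕ.zero}  g = refl
prodℤᶠ≡prod {ℕ.suc k} g = cong (g zero *_) (prodℤᶠ≡prod (g ∘ suc))

sum-supported-at : ∀ {k} (g : Fin k → ℤ) z → (∀ i → i ≢ z → g i ≡ + 0) → sum g ≡ g z
sum-supported-at {ℕ.suc k} g zero    h = begin
  g zero + sum (g ∘ suc)        ≡⟨ cong (_+_ (g zero)) (sum-cong-≗ {k} (λ i → h (suc i) λ ())) ⟩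
  g zero + sum {k} (λ _ → + 0)  ≡⟨ cong (_+_ (g zero)) (sum-replicate-zero k) ⟩
  g zero + + 0                  ≡⟨ ℤP.+-identityʳ (g zero) ⟩
  g zero                        ∎
  where open ≡-Reasoning
sum-supported-at {ℕ.suc k} g (suc z) h = begin
  g zero + sum (g ∘ suc)        ≡⟨ cong (_+ sum (g ∘ suc)) (h zero λ ()) ⟩
  + 0 + sum (g ∘ suc)           ≡⟨ ℤP.+-identityˡ _ ⟩
  sum (g ∘ suc)                 ≡⟨ sum-supported-at (g ∘ suc) z (λ i i≢z → h (suc i) (i≢z ∘ FinP.suc-injective)) ⟩
  g (suc z)                     ∎
  where open ≡-Reasoning

sum-if-const : ∀ {k} (p : Fin k → Bool) c → sum (λ i → if p i then c else + 0) ≡ c * + countᶠ p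
sum-if-const {ℕ.zero}  p c = sym (ℤP.*-zeroʳ c)
sum-if-const {ℕ.suc k} p c with p zero
... | true  = trans (cong (_+_ c) (sum-if-const (p ∘ suc) c)) (c+c*x≡c*[1+x] c _)
  where c+c*x≡c*[1+x] : ∀ c x → c + c * x ≡ c * (+ 1 + x)
        c+c*x≡c*[1+x] = solve-∀
... | false = trans (ℤP.+-identityˡ _) (sum-if-const (p ∘ suc) c)

prod-zero : ∀ {k} (g : Fin k → ℤ) z → g z ≡ + 0 → prod g ≡ + 0
prod-zero {ℕ.suc k} g zero    gz≡0 = cong (_* prod (g ∘ suc)) gz≡0
prod-zero {ℕ.suc k} g (suc z) gz≡0 = trans (cong (g zero *_) (prod-zero (g ∘ suc) z gz≡0)) (ℤP.*-zeroʳ (g zero))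

prod-one : ∀ {k} (g : Fin k → ℤ) → (∀ i → g i ≡ + 1) → prod g ≡ + 1
prod-one {k} g g≡1 = trans (prod-cong-≗ g≡1) (prod-replicate-one k)

prod-indicator : ∀ {k} (b : Fin k → Bool) → prod (λ i → [ b i ]ℤ) ≡ [ allᶠ b ]ℤ
prod-indicator {ℕ.zero}  b = refl
prod-indicator {ℕ.suc k} b with b zero
... | true  = trans (ℤP.*-identityˡ _) (prod-indicator (b ∘ suc))
... | false = refl

prod-if : ∀ {k} (b : Fin k → Bool) x y →
  prod (λ i → if b i then x else y) ≡ x ^ countᶠ b * y ^ countᶠ (not ∘ b)
prod-if {ℕ.zero}  b x y = refl
prod-if {ℕ.suc k} b x y with b zero
... | true  = trans (cong (x *_) (prod-if (b ∘ suc) x y)) (sym (ℤP.*-assoc x _ _))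
... | false = trans (cong (y *_) (prod-if (b ∘ suc) x y))
                    (y*[a*c]≡a*[y*c] y (x ^ countᶠ (b ∘ suc)) (y ^ countᶠ (not ∘ b ∘ suc)))
  where y*[a*c]≡a*[y*c] : ∀ y a c → y * (a * c) ≡ a * (y * c)
        y*[a*c]≡a*[y*c] = solve-∀

sumVec : ∀ {M} n → (Vec (Fin M) n → ℤ) → ℤ
sumVec ℕ.zero    g = g []
sumVec (ℕ.suc n) g = sum (λ j → sumVec n (g ∘ (j ∷_)))

module _ {M : ℕ} where

  sumVec-cong : ∀ n {g h : Vec (Fin M) n → ℤ} → (∀ v → g v ≡ h v) → sumVec n g ≡ sumVec n h
  sumVec-cong ℕ.zero    g≗h = g≗h []
  sumVec-cong (ℕ.suc n) g≗h = sum-cong-≗ (λ j → sumVec-cong n (g≗h ∘ (j ∷_)))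

  *-distribˡ-sumVec : ∀ n c (g : Vec (Fin M) n → ℤ) → c * sumVec n g ≡ sumVec n (λ v → c * g v)
  *-distribˡ-sumVec ℕ.zero    c g = refl
  *-distribˡ-sumVec (ℕ.suc n) c g =
    trans (*-distribˡ-sum c (λ j → sumVec n (g ∘ (j ∷_)))) (sum-cong-≗ (λ j → *-distribˡ-sumVec n c (g ∘ (j ∷_))))

  *-distribʳ-sumVec : ∀ n c (g : Vec (Fin M) n → ℤ) → sumVec n g * c ≡ sumVec n (λ v → g v * c)
  *-distribʳ-sumVec ℕ.zero    c g = refl
  *-distribʳ-sumVec (ℕ.suc n) c g =
    trans (*-distribʳ-sum c (λ j → sumVec n (g ∘ (j ∷_)))) (sum-cong-≗ (λ j → *-distribʳ-sumVec n c (g ∘ (j ∷_))))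

  sum-sumVec-comm : ∀ {k} n (g : Fin k → Vec (Fin M) n → ℤ) →
    sum (λ y → sumVec n (g y)) ≡ sumVec n (λ v → sum (λ y → g y v))
  sum-sumVec-comm ℕ.zero    g = refl
  sum-sumVec-comm (ℕ.suc n) g =
    trans (∑-comm (λ y j → sumVec n (g y ∘ (j ∷_))))
          (sum-cong-≗ (λ j → sum-sumVec-comm n (λ y → g y ∘ (j ∷_))))

  sumVec-prod : ∀ n (W : Fin n → Fin M → ℤ) →
    sumVec n (λ v → prod (λ i → W i (lookup v i))) ≡ prod (λ i → sum (W i))
  sumVec-prod ℕ.zero    W = refl
  sumVec-prod (ℕ.suc n) W = begin
    sum (λ j → sumVec n (λ v → W zero j * prod (λ i → W (suc i) (lookup v i))))
      ≡⟨ sum-cong-≗ (λ j → sym (*-distribˡ-sumVec n (W zero j) _)) ⟩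
    sum (λ j → W zero j * sumVec n (λ v → prod (λ i → W (suc i) (lookup v i))))
      ≡⟨ sum-cong-≗ (λ j → cong (W zero j *_) (sumVec-prod n (W ∘ suc))) ⟩
    sum (λ j → W zero j * prod (λ i → sum (W (suc i))))
      ≡⟨ sym (*-distribʳ-sum _ (W zero)) ⟩
    sum (W zero) * prod (λ i → sum (W (suc i)))
      ∎
    where open ≡-Reasoning

  sum-fibres : ∀ {k} n (F : Vec (Fin M) n → Fin k) (w : Vec (Fin M) n → ℤ) (h : Fin k → ℤ) →
    sum (λ y → sumVec n (λ v → if ⌊ F v FinP.≟ y ⌋ then w v else + 0) * h y) ≡ sumVec n (λ v → w v * h (F v))
  sum-fibres {k} n F w h = begin
    sum (λ y → sumVec n (λ v → if ⌊ F v FinP.≟ y ⌋ then w v else + 0) * h y)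
      ≡⟨ sum-cong-≗ (λ y → *-distribʳ-sumVec n (h y) (λ v → if ⌊ F v FinP.≟ y ⌋ then w v else + 0)) ⟩
    sum (λ y → sumVec n (term y))
      ≡⟨ sum-sumVec-comm n term ⟩
    sumVec n (λ v → sum (λ y → term y v))
      ≡⟨ sumVec-cong n (λ v → sum-supported-at (λ y → term y v) (F v) (off v)) ⟩
    sumVec n (λ v → term (F v) v)
      ≡⟨ sumVec-cong n on ⟩
    sumVec n (λ v → w v * h (F v))
      ∎
    where
    open ≡-Reasoning
    term : Fin k → Vec (Fin M) n → ℤ
    term y v = (if ⌊ F v FinP.≟ y ⌋ then w v else + 0) * h y
    off : ∀ v y → y ≢ F v → term y v ≡ + 0
    off v y y≢Fv = trans (cong (_* h y) (if-false {b = ⌊ F v FinP.≟ y ⌋} (y≢Fv ∘ sym ∘ toWitness)))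
                         (ℤP.*-zeroˡ (h y))
    on : ∀ v → term (F v) v ≡ w v * h (F v)
    on v = cong (λ b → (if b then w v else + 0) * h (F v)) (to T-≡ (fromWitness {a? = F v FinP.≟ F v} refl))

  countVec : ∀ n → (Vec (Fin M) n → Bool) → ℕ
  countVec ℕ.zero    q = if q [] then 1 else 0
  countVec (ℕ.suc n) q = sumℕ (λ j → countVec n (q ∘ (j ∷_)))

  sumVec-if-const : ∀ n (q : Vec (Fin M) n → Bool) c →
    sumVec n (λ v → if q v then c else + 0) ≡ c * + countVec n q
  sumVec-if-const ℕ.zero    q c with q []
  ... | true  = sym (ℤP.*-identityʳ c)
  ... | false = sym (ℤP.*-zeroʳ c)
  sumVec-if-const (ℕ.suc n) q c = begin
    sum (λ j → sumVec n (λ v → if q (j ∷ v) then c else + 0))  ≡⟨ sum-cong-≗ (λ j → sumVec-if-const n (q ∘ (j ∷_)) c) ⟩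
    sum (λ j → c * + countVec n (q ∘ (j ∷_)))                  ≡⟨ *-distribˡ-sum c (+_ ∘ counts) ⟨
    c * sum (+_ ∘ counts)                                      ≡⟨ cong (c *_) (+-sumℕ counts) ⟨
    c * + countVec (ℕ.suc n) q                                 ∎
    where
    open ≡-Reasoning
    counts : Fin M → ℕ
    counts j = countVec n (q ∘ (j ∷_))
    +-sumℕ : ∀ {k} (c : Fin k → ℕ) → + sumℕ c ≡ sum (+_ ∘ c)
    +-sumℕ {ℕ.zero}  c = refl
    +-sumℕ {ℕ.suc k} c = trans (ℤP.pos-+ (c zero) _) (cong (_+_ (+ c zero)) (+-sumℕ (c ∘ suc)))

  countVec-↔ : ∀ n (q : Vec (Fin M) n → Bool) → Fin (countVec n q) ↔ Σ (Vec (Fin M) n) (T ∘ q)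
  countVec-↔ ℕ.zero    q =
    ↔-trans (if-↔ (q [])) (mk↔ₛ′ ([] ,_) (λ { ([] , p) → p }) (λ { ([] , p) → refl }) λ _ → refl)
    where
    if-↔ : ∀ b → Fin (if b then 1 else 0) ↔ T b
    if-↔ true  = mk↔ₛ′ (λ _ → tt) (λ _ → zero) (λ _ → refl) λ { zero → refl ; (suc ()) }
    if-↔ false = mk↔ₛ′ (λ ()) (λ ()) (λ ()) λ ()
  countVec-↔ (ℕ.suc n) q =
    ↔-trans (Fin-sumℕ-↔ (λ j → countVec n (q ∘ (j ∷_))))
    (↔-trans (Σ-↔ ↔-refl (λ {j} → countVec-↔ n (q ∘ (j ∷_))))
    (mk↔ₛ′ (λ { (j , v , p) → j ∷ v , p }) (λ { (j ∷ v , p) → j , v , p })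
           (λ { (j ∷ v , p) → refl }) (λ { (j , v , p) → refl })))
    where
    Σ-Fin-suc-↔ : ∀ {k} (B : Fin (ℕ.suc k) → Set) → (B zero ⊎ Σ (Fin k) (B ∘ suc)) ↔ Σ (Fin (ℕ.suc k)) B
    Σ-Fin-suc-↔ B = mk↔ₛ′ (λ { (inj₁ b) → zero , b ; (inj₂ (i , b)) → suc i , b })
                           (λ { (zero , b) → inj₁ b ; (suc i , b) → inj₂ (i , b) })
                           (λ { (zero , b) → refl ; (suc i , b) → refl })
                           (λ { (inj₁ b) → refl ; (inj₂ (i , b)) → refl })
    Fin-sumℕ-↔ : ∀ {k} (c : Fin k → ℕ) → Fin (sumℕ c) ↔ Σ (Fin k) (Fin ∘ c)
    Fin-sumℕ-↔ {ℕ.zero}  c = mk↔ₛ′ (λ ()) (λ ()) (λ ()) (λ ())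
    Fin-sumℕ-↔ {ℕ.suc k} c =
      ↔-trans FinP.+↔⊎ (↔-trans (↔-refl ⊎-↔ Fin-sumℕ-↔ (c ∘ suc)) (Σ-Fin-suc-↔ (Fin ∘ c)))

measure-wellFounded : ∀ {A : Set} {_≺_ : A → A → Set} (d : A → ℕ) →
  (∀ {u z} → u ≺ z → d u ℕ.< d z) → WellFounded _≺_
measure-wellFounded d decr = Subrelation.wellFounded decr (On.wellFounded d <-wellFounded)

module Order (P : FinPoset) where
  open FinPoset P

  infix 4 _≼_ _≺_ _⋖_

  _≼_ _≺_ _⋖_ : Fin N → Fin N → Set
  x ≼ y = T (le x y)
  x ≺ y = T (lt P x y)
  x ⋖ y = T (covers P x y)

  eqb⇒≡ : ∀ {x y} → T (eqb P x y) → x ≡ y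
  eqb⇒≡ {x} {y} = toWitness {a? = x FinP.≟ y}

  ≡⇒eqb : ∀ {x y} → x ≡ y → T (eqb P x y)
  ≡⇒eqb {x} {y} = fromWitness {a? = x FinP.≟ y}

  ≺⇒≼ : ∀ {x y} → x ≺ y → x ≼ y
  ≺⇒≼ = proj₁ ∘ to T-∧

  ≺⇒≢ : ∀ {x y} → x ≺ y → x ≢ y
  ≺⇒≢ x≺y x≡y = T-not⇒¬T (proj₂ (to T-∧ x≺y)) (≡⇒eqb x≡y)

  ≼∧≢⇒≺ : ∀ {x y} → x ≼ y → x ≢ y → x ≺ y
  ≼∧≢⇒≺ x≼y x≢y = from T-∧ (x≼y , ¬T⇒T-not (x≢y ∘ eqb⇒≡))

  ≺-irrefl : ∀ {x} → ¬ x ≺ x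
  ≺-irrefl x≺x = ≺⇒≢ x≺x refl

  ≺-≼-trans : ∀ {x y z} → x ≺ y → y ≼ z → x ≺ z
  ≺-≼-trans {x} {y} {z} x≺y y≼z = ≼∧≢⇒≺ (le-trans x y z (≺⇒≼ x≺y) y≼z)
    λ { refl → ≺⇒≢ x≺y (le-antisym x y (≺⇒≼ x≺y) y≼z) }

  ≼-bot : ∀ {x} → x ≼ bot → x ≡ bot
  ≼-bot {x} x≼bot = le-antisym x bot x≼bot (bot-min x)

  ≺-wellFounded : WellFounded _≺_
  ≺-wellFounded = measure-wellFounded (λ z → countᶠ (λ w → lt P w z))
    λ {u} {z} u≺z → count-strict _ _ (λ w w≺u → ≺-≼-trans w≺u (≺⇒≼ u≺z)) u u≺z ≺-irrefl

  ≻-wellFounded : WellFounded (λ u z → z ≺ u)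
  ≻-wellFounded = measure-wellFounded (λ z → countᶠ (lt P z))
    λ {u} {z} z≺u → count-strict _ _ (λ w u≺w → ≺-≼-trans z≺u (≺⇒≼ u≺w)) u z≺u ≺-irrefl

  ⋖⇒≺ : ∀ {x y} → x ⋖ y → x ≺ y
  ⋖⇒≺ = proj₁ ∘ to T-∧

  ⋖-nothing-between : ∀ {x y} → x ⋖ y → ∀ u → x ≺ u → ¬ u ≺ y
  ⋖-nothing-between x⋖y u x≺u u≺y =
    T-not⇒¬T (All.lookup (AllP.all⁺ _ (allFin N) (proj₂ (to T-∧ x⋖y))) (∈-allFin u)) (from T-∧ (x≺u , u≺y))

  ⋖-intro : ∀ {x y} → x ≺ y → (∀ u → x ≺ u → ¬ u ≺ y) → x ⋖ y
  ⋖-intro {x} {y} x≺y between = from T-∧ (x≺y , AllP.all⁻ (λ u → not (lt P x u ∧ lt P u y)) {allFin N} (All.tabulate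
    λ {u} _ → ¬T⇒T-not λ x≺u≺y →
      between u (proj₁ (to (T-∧ {lt P x u}) x≺u≺y)) (proj₂ (to (T-∧ {lt P x u}) x≺u≺y))))

  minimal-element : (S : Fin N → Bool) → ∀ {w} → T (S w) → ∃ λ z → T (S z) × (∀ u → T (S u) → ¬ u ≺ z)
  minimal-element S = go (≺-wellFounded _)
    where
    go : ∀ {w} → Acc _≺_ w → T (S w) → ∃ λ z → T (S z) × (∀ u → T (S u) → ¬ u ≺ z)
    go {w} (acc below) Sw with FinP.any? (λ u → T? (S u ∧ lt P u w))
    ... | yes (u , Su∧u≺w) = go (below (proj₂ (to (T-∧ {S u}) Su∧u≺w))) (proj₁ (to (T-∧ {S u}) Su∧u≺w))
    ... | no  none         = w , Sw , λ u Su u≺w → none (u , from (T-∧ {S u}) (Su , u≺w))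

  -- A minimal element of the interval (y, x] covers y.
  cover-below : ∀ {y x} → y ≺ x → ∃ λ z → y ⋖ z × z ≼ x
  cover-below {y} {x} y≺x with minimal-element (λ z → lt P y z ∧ le z x) (from T-∧ (y≺x , le-refl x))
  ... | z , Sz , minimal = z , ⋖-intro y≺z (λ u y≺u u≺z → minimal u (from T-∧ (y≺u , u≼x u≺z)) u≺z) , z≼x
    where
    y≺z = proj₁ (to T-∧ Sz)
    z≼x = proj₂ (to T-∧ Sz)
    u≼x : ∀ {u} → u ≺ z → u ≼ x
    u≼x {u} u≺z = le-trans u z x (≺⇒≼ u≺z) z≼x

  atom-below : ∀ {x} → x ≢ bot → ∃ λ a → T (isAtom P a) × a ≼ x
  atom-below {x} x≢bot = cover-below (≼∧≢⇒≺ (bot-min x) (x≢bot ∘ sym))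

  atom≢bot : ∀ {a} → T (isAtom P a) → a ≢ bot
  atom≢bot bot⋖a a≡bot = ≺⇒≢ (⋖⇒≺ bot⋖a) (sym a≡bot)

  atom≼-unique : ∀ {a b} → T (isAtom P a) → T (isAtom P b) → b ≼ a → b ≡ a
  atom≼-unique {a} {b} bot⋖a bot⋖b b≼a with b FinP.≟ a
  ... | yes b≡a = b≡a
  ... | no  b≢a = ⊥-elim (⋖-nothing-between bot⋖a b (⋖⇒≺ bot⋖b) (≼∧≢⇒≺ b≼a b≢a))

  sum-≼-split : ∀ (g : Fin N → ℤ) x →
    sum (λ y → if le y x then g y else + 0) ≡ g x + sum (λ y → if lt P y x then g y else + 0)
  sum-≼-split g x = begin
    sum (λ y → if le y x then g y else + 0)
      ≡⟨ sum-cong-≗ split ⟩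
    sum (λ y → (if eqb P y x then g y else + 0) + (if lt P y x then g y else + 0))
      ≡⟨ ∑-distrib-+ (λ y → if eqb P y x then g y else + 0) (λ y → if lt P y x then g y else + 0) ⟩
    sum (λ y → if eqb P y x then g y else + 0) + sum (λ y → if lt P y x then g y else + 0)
      ≡⟨ cong (_+ lower) (sum-supported-at (λ y → if eqb P y x then g y else + 0) x λ y y≢x → if-false (y≢x ∘ eqb⇒≡)) ⟩
    (if eqb P x x then g x else + 0) + sum (λ y → if lt P y x then g y else + 0)
      ≡⟨ cong (λ b → (if b then g x else + 0) + lower) (to T-≡ (≡⇒eqb {x} refl)) ⟩
    g x + sum (λ y → if lt P y x then g y else + 0)
      ∎
    where
    open ≡-Reasoning
    lower : ℤ
    lower = sum (λ y → if lt P y x then g y else + 0)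
    split : ∀ y → (if le y x then g y else + 0) ≡ (if eqb P y x then g y else + 0) + (if lt P y x then g y else + 0)
    split y with le y x in y≼x | eqb P y x in y≡x
    ... | true  | true  = sym (ℤP.+-identityʳ _)
    ... | true  | false = sym (ℤP.+-identityˡ _)
    ... | false | true  = ⊥-elim (subst T y≼x (subst (λ z → T (le z x)) (sym (eqb⇒≡ (from T-≡ y≡x))) (le-refl x)))
    ... | false | false = refl

  mobius-unique : ∀ {μ ν} → IsMobius P μ → IsMobius P ν → ∀ x → μ x ≡ ν x
  mobius-unique {μ} {ν} μ-mobius ν-mobius x = go (≺-wellFounded x)
    where
    strict-lower-sum : ∀ {g} → IsMobius P g → ∀ x → g x + sum (λ y → if lt P y x then g y else + 0) ≡ [ eqb P x bot ]ℤ
    strict-lower-sum {g} g-mobius x =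
      trans (sym (sum-≼-split g x)) (trans (sym (sumℤᶠ≡sum (λ y → if le y x then g y else + 0))) (g-mobius x))
    go : ∀ {x} → Acc _≺_ x → μ x ≡ ν x
    go {x} (acc below) = ∙-cancelʳ _ (μ x) (ν x) (begin
      μ x + sum (λ y → if lt P y x then ν y else + 0)  ≡⟨ cong (_+_ (μ x)) (sum-cong-≗ agree) ⟨
      μ x + sum (λ y → if lt P y x then μ y else + 0)  ≡⟨ strict-lower-sum μ-mobius x ⟩
      [ eqb P x bot ]ℤ                                 ≡⟨ strict-lower-sum ν-mobius x ⟨
      ν x + sum (λ y → if lt P y x then ν y else + 0)  ∎)
      where
      open ≡-Reasoning
      agree : ∀ y → (if lt P y x then μ y else + 0) ≡ (if lt P y x then ν y else + 0)
      agree y with lt P y x in y≺x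
      ... | true  = go (below (from T-≡ y≺x))
      ... | false = refl

module Chains (P : FinPoset) (n : ℕ) (blk : Fin (FinPoset.N P) → Fin n) where
  open FinPoset P
  open Order P

  InA InU : Fin n → Fin N → Bool
  InA = inA P n blk
  InU = inU P n blk

  IsChain : Fin n → List (Fin N) → Bool
  IsChain = isChain P n blk

  topOf : List (Fin N) → Fin N
  topOf = top P n blk

  inA⇒atom : ∀ {i a} → T (InA i a) → T (isAtom P a)
  inA⇒atom = proj₁ ∘ to T-∧

  atom⇒inA : ∀ {a} → T (isAtom P a) → T (InA (blk a) a)
  atom⇒inA {a} atom = from T-∧ (atom , fromWitness {a? = blk a FinP.≟ blk a} refl)

  inU-above : ∀ {i b y} → T (InA i b) → b ≼ y → T (InU i y)
  inU-above {i} {b} {y} b∈Aᵢ b≼y = from (T-∨ {eqb P y bot})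
    (inj₂ (AnyP.any⁺ (λ a → InA i a ∧ le a y) (lose (∈-allFin b) (from T-∧ (b∈Aᵢ , b≼y)))))

  atom-inU⇒inA : ∀ {i a} → T (isAtom P a) → T (InU i a) → T (InA i a)
  atom-inU⇒inA {i} {a} atom a∈Uᵢ with to (T-∨ {eqb P a bot}) a∈Uᵢ
  ... | inj₁ a≡bot = ⊥-elim (atom≢bot atom (eqb⇒≡ a≡bot))
  ... | inj₂ some with satisfied (AnyP.any⁻ (λ b → InA i b ∧ le b a) (allFin N) some)
  ...   | b , b∈Aᵢ∧b≼a = subst (T ∘ InA i) (atom≼-unique atom (inA⇒atom b∈Aᵢ) b≼a) b∈Aᵢ
    where b∈Aᵢ = proj₁ (to (T-∧ {InA i b}) b∈Aᵢ∧b≼a)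
          b≼a  = proj₂ (to (T-∧ {InA i b}) b∈Aᵢ∧b≼a)

  bot∈chain : ∀ {i C} → T (IsChain i C) → bot ∈ C
  bot∈chain {C = x ∷ _} isC = here (sym (eqb⇒≡ (proj₁ (to (T-∧ {eqb P x bot}) isC))))

  top-snoc : ∀ C z → topOf (C ++ z ∷ []) ≡ z
  top-snoc []           z = refl
  top-snoc (x ∷ [])     z = refl
  top-snoc (x ∷ y ∷ ys) z = top-snoc (y ∷ ys) z

  chainSteps-snoc : ∀ {i} x ys z → T (chainSteps P n blk i x ys) → topOf (x ∷ ys) ⋖ z → T (InU i z) →
    T (chainSteps P n blk i x (ys ++ z ∷ []))
  chainSteps-snoc x []       z _     x⋖z z∈Uᵢ = from (T-∧ {covers P x z}) (x⋖z , from (T-∧ {InU _ z}) (z∈Uᵢ , tt))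
  chainSteps-snoc x (y ∷ ys) z steps y⋖z z∈Uᵢ =
    from (T-∧ {covers P x y}) (proj₁ (to (T-∧ {covers P x y}) steps) ,
      from (T-∧ {InU _ y}) (proj₁ (to (T-∧ {InU _ y}) rest) ,
        chainSteps-snoc y ys z (proj₂ (to (T-∧ {InU _ y}) rest)) y⋖z z∈Uᵢ))
    where rest = proj₂ (to (T-∧ {covers P x y}) steps)

  chain-snoc : ∀ {i} C z → T (IsChain i C) → topOf C ⋖ z → T (InU i z) → T (IsChain i (C ++ z ∷ []))
  chain-snoc (x ∷ ys) z isC x⋖z z∈Uᵢ =
    from (T-∧ {eqb P x bot}) (proj₁ (to (T-∧ {eqb P x bot}) isC) ,
      chainSteps-snoc x ys z (proj₂ (to (T-∧ {eqb P x bot}) isC)) x⋖z z∈Uᵢ)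

  extend : ∀ {i b} → T (InA i b) → ∀ C x → T (IsChain i C) → b ≼ topOf C → topOf C ≼ x →
    ∃ λ D → T (IsChain i D) × topOf D ≡ x × C ⊆ D
  extend {i} {b} b∈Aᵢ C x = go (≻-wellFounded (topOf C)) C refl
    where
    go : ∀ {y} → Acc (λ u z → z ≺ u) y → ∀ C → topOf C ≡ y → T (IsChain i C) → b ≼ y → y ≼ x →
      ∃ λ D → T (IsChain i D) × topOf D ≡ x × C ⊆ D
    go {y} (acc above) C refl isC b≼y y≼x with y FinP.≟ x
    ... | yes refl = C , isC , refl , ⊆-refl
    ... | no y≢x with cover-below (≼∧≢⇒≺ y≼x y≢x)
    ... | z , y⋖z , z≼x with go (above (⋖⇒≺ y⋖z)) (C ++ z ∷ []) (top-snoc C z)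
                              (chain-snoc C z isC y⋖z (inU-above b∈Aᵢ b≼z)) b≼z z≼x
      where b≼z = le-trans b y z b≼y (≺⇒≼ (⋖⇒≺ y⋖z))
    ... | D , isD , topD≡x , C++z⊆D = D , isD , topD≡x , C++z⊆D ∘ xs⊆xs++ys C (z ∷ [])

  atomChain : ∀ {i a} → T (InA i a) → T (IsChain i (bot ∷ a ∷ []))
  atomChain {i} {a} a∈Aᵢ = from (T-∧ {eqb P bot bot}) (≡⇒eqb {bot} refl ,
    from (T-∧ {isAtom P a}) (inA⇒atom a∈Aᵢ , from (T-∧ {InU i a}) (inU-above a∈Aᵢ (le-refl a) , tt)))

  chain-through : ∀ {i b x} → T (InA i b) → b ≼ x → ∃ λ D → T (IsChain i D) × topOf D ≡ x × b ∈ D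
  chain-through {i} {b} {x} b∈Aᵢ b≼x with extend b∈Aᵢ (bot ∷ b ∷ []) x (atomChain b∈Aᵢ) (le-refl b) b≼x
  ... | D , isD , topD≡x , C⊆D = D , isD , topD≡x , C⊆D (there (here refl))

module Transversal (P : FinPoset) (n : ℕ) (blk : Fin (FinPoset.N P) → Fin n)
                   (f : Tuple P n blk → Fin (FinPoset.N P)) (transversal : IsCompleteTransversal P n blk f) where
  open FinPoset P
  open Order P
  open Chains P n blk

  f-mono : ∀ s t → _≤T_ P n blk s t → f s ≼ f t
  f-mono = proj₁ transversal

  component-chain : ∀ (t : Tuple P n blk) i → T (IsChain i (comp P n blk t i))
  component-chain t = allᶠ-elim _ (proj₂ t)

  tuple : (g : Fin n → List (Fin N)) → (∀ i → T (IsChain i (g i))) → Tuple P n blk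
  tuple g isC = tabulate g , allᶠ-intro _ (λ i → subst (T ∘ IsChain i) (sym (lookup∘tabulate g i)) (isC i))

  tuple-mono : ∀ g h {isCg isCh} → (∀ i → g i ⊆ h i) → _≤T_ P n blk (tuple g isCg) (tuple h isCh)
  tuple-mono g h g⊆h i y y∈gᵢ =
    subst (y ∈_) (sym (lookup∘tabulate h i)) (g⊆h i (subst (y ∈_) (lookup∘tabulate g i) y∈gᵢ))

  f-tuple : ∀ g isC x → (∀ i → topOf (g i) ≡ bot ⊎ topOf (g i) ≡ x) → (x ≡ bot ⊎ ∃ λ i → topOf (g i) ≡ x) →
    f (tuple g isC) ≡ x
  f-tuple g isC x tops reached = proj₂ transversal (tuple g isC) x
    (λ i → subst (λ C → topOf C ≡ bot ⊎ topOf C ≡ x) (sym (lookup∘tabulate g i)) (tops i))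
    (map₂ (λ { (i , topᵢ) → i , trans (cong topOf (lookup∘tabulate g i)) topᵢ }) reached)

  botChain : ∀ i → T (IsChain i (bot ∷ []))
  botChain i = from (T-∧ {eqb P bot bot}) (≡⇒eqb {bot} refl , tt)

  bot⊆chain : ∀ {i C} → T (IsChain i C) → bot ∷ [] ⊆ C
  bot⊆chain {i} isC (here refl) = bot∈chain {i} isC

  botTuple : Tuple P n blk
  botTuple = tuple (λ _ → bot ∷ []) botChain

  f-botTuple : f botTuple ≡ bot
  f-botTuple = f-tuple (λ _ → bot ∷ []) botChain bot (λ _ → inj₁ refl) (inj₁ refl)

  onlyAt : Fin n → List (Fin N) → Fin n → List (Fin N)
  onlyAt i C j = if ⌊ j FinP.≟ i ⌋ then C else bot ∷ []

  onlyAt-here : ∀ i C → onlyAt i C i ≡ C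
  onlyAt-here i C with i FinP.≟ i
  ... | yes _  = refl
  ... | no i≢i = ⊥-elim (i≢i refl)

  onlyAt-chain : ∀ {i C} → T (IsChain i C) → ∀ j → T (IsChain j (onlyAt i C j))
  onlyAt-chain {i} isC j with j FinP.≟ i
  ... | yes refl = isC
  ... | no _     = botChain j

  onlyAt-⊆ : ∀ (i : Fin n) {C : List (Fin N)} (g : Fin n → List (Fin N)) → (∀ j → T (IsChain j (g j))) →
    C ⊆ g i → ∀ j → onlyAt i C j ⊆ g j
  onlyAt-⊆ i g isC C⊆gᵢ j with j FinP.≟ i
  ... | yes refl = C⊆gᵢ
  ... | no _     = bot⊆chain {j} (isC j)

  single : ∀ i C → T (IsChain i C) → Tuple P n blk
  single i C isC = tuple (onlyAt i C) (onlyAt-chain isC)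

  f-single : ∀ i C isC → f (single i C isC) ≡ topOf C
  f-single i C isC = f-tuple (onlyAt i C) (onlyAt-chain isC) (topOf C) tops (inj₂ (i , cong topOf (onlyAt-here i C)))
    where
    tops : ∀ j → topOf (onlyAt i C j) ≡ bot ⊎ topOf (onlyAt i C j) ≡ topOf C
    tops j with j FinP.≟ i
    ... | yes _ = inj₂ refl
    ... | no _  = inj₁ refl

  single-≤-tuple : ∀ i {C} (isC : T (IsChain i C)) g (isCg : ∀ j → T (IsChain j (g j))) → C ⊆ g i →
    _≤T_ P n blk (single i C isC) (tuple g isCg)
  single-≤-tuple i {C} isC g isCg C⊆gᵢ =
    tuple-mono (onlyAt i C) g {onlyAt-chain {i} isC} {isCg} (onlyAt-⊆ i g isCg C⊆gᵢ)

  single-mono : ∀ i {C D} (isC : T (IsChain i C)) (isD : T (IsChain i D)) → C ⊆ D →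
    _≤T_ P n blk (single i C isC) (single i D isD)
  single-mono i {D = D} isC isD C⊆D =
    single-≤-tuple i isC (onlyAt i D) (onlyAt-chain {i} isD) (subst (_ ⊆_) (sym (onlyAt-here i D)) C⊆D)

  comparable-representatives : ∀ {y x} → y ≼ x →
    ∃ λ s′ → ∃ λ t′ → f s′ ≡ y × f t′ ≡ x × _≤T_ P n blk s′ t′
  comparable-representatives {y} {x} y≼x with y FinP.≟ bot | x FinP.≟ bot
  ... | _        | yes refl = botTuple , botTuple , trans f-botTuple (sym (≼-bot y≼x)) , f-botTuple , λ _ _ m → m
  ... | yes refl | no x≢bot with atom-below x≢bot
  ...   | a , atom , a≼x with chain-through (atom⇒inA atom) a≼x
  ...     | D , isD , topD≡x , _ =
    single (blk a) _ (botChain (blk a)) , single (blk a) D isD , f-single (blk a) _ (botChain (blk a)) ,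
    trans (f-single (blk a) D isD) topD≡x , single-mono (blk a) (botChain (blk a)) isD (bot⊆chain isD)
  comparable-representatives {y} {x} y≼x | no y≢bot | no _ with atom-below y≢bot
  ... | a , atom , a≼y with chain-through (atom⇒inA atom) a≼y
  ...   | C , isC , refl , _ with extend (atom⇒inA atom) C x isC a≼y y≼x
  ...     | D , isD , topD≡x , C⊆D =
    single (blk a) C isC , single (blk a) D isD , f-single (blk a) C isC ,
    trans (f-single (blk a) D isD) topD≡x , single-mono (blk a) isC isD C⊆D

  quotientIso : QuotientIso P n blk f
  quotientIso = f , (λ _ _ → mk⇔ id id)
                  , (λ x → let _ , t , _ , ft≡x , _ = comparable-representatives (bot-min x) in t , ft≡x)
                  , λ s t → mk⇔ comparable-representatives λ { (s′ , t′ , fs′≡fs , ft′≡ft , s′≤t′) →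
                                 subst₂ _≼_ fs′≡fs ft′≡ft (f-mono s′ t′ s′≤t′) }

  -- Atomic tuples, encoded by choice vectors: the entry suc a in coordinate i selects the
  -- chain 0̂ ⋖ a when a ∈ A_i; the entry zero, and every other entry, selects 0̂.
  Choice : Set
  Choice = Vec (Fin (ℕ.suc N)) n

  choiceChain : Fin n → Fin (ℕ.suc N) → List (Fin N)
  choiceChain i zero    = bot ∷ []
  choiceChain i (suc a) = if InA i a then bot ∷ a ∷ [] else bot ∷ []

  choiceChain-inA : ∀ {i a} → T (InA i a) → choiceChain i (suc a) ≡ bot ∷ a ∷ []
  choiceChain-inA {i} {a} a∈Aᵢ with InA i a
  ... | true = refl

  choiceChain-chain : ∀ i j → T (IsChain i (choiceChain i j))
  choiceChain-chain i zero    = botChain i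
  choiceChain-chain i (suc a) with InA i a in a∈Aᵢ
  ... | true  = atomChain (from T-≡ a∈Aᵢ)
  ... | false = botChain i

  admissible : Fin n → Fin (ℕ.suc N) → Bool
  admissible i zero    = true
  admissible i (suc a) = InA i a

  chosen : Fin n → Fin (ℕ.suc N) → Bool
  chosen i j = 1 ℕ.<ᵇ length (choiceChain i j)

  atomicTuple : Choice → Tuple P n blk
  atomicTuple v = tuple (λ i → choiceChain i (lookup v i)) (λ i → choiceChain-chain i (lookup v i))

  F : Choice → Fin N
  F v = f (atomicTuple v)

  comp-atomicTuple : ∀ v i → comp P n blk (atomicTuple v) i ≡ choiceChain i (lookup v i)
  comp-atomicTuple v i = lookup∘tabulate (λ i → choiceChain i (lookup v i)) i

  choiceBelow : Fin N → Fin n → Fin (ℕ.suc N) → Bool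
  choiceBelow x i zero    = true
  choiceBelow x i (suc a) = if InA i a then le a x else true

  chosen-atom-≼-F : ∀ v i a → lookup v i ≡ suc a → T (InA i a) → a ≼ F v
  chosen-atom-≼-F v i a vᵢ≡a a∈Aᵢ = subst (_≼ F v) (f-single i (bot ∷ a ∷ []) (atomChain {i} a∈Aᵢ))
    (f-mono _ (atomicTuple v) (single-≤-tuple i (atomChain {i} a∈Aᵢ) _ (λ j → choiceChain-chain j (lookup v j))
                                               (⊆-reflexive (sym chainᵢ))))
    where
    chainᵢ : choiceChain i (lookup v i) ≡ bot ∷ a ∷ []
    chainᵢ = trans (cong (choiceChain i) vᵢ≡a) (choiceChain-inA a∈Aᵢ)

  F-≼⇒ : ∀ v x → F v ≼ x → ∀ i → T (choiceBelow x i (lookup v i))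
  F-≼⇒ v x Fv≼x i with lookup v i in vᵢ
  ... | zero  = tt
  ... | suc a with InA i a in a∈Aᵢ
  ...   | true  = le-trans a (F v) x (chosen-atom-≼-F v i a vᵢ (from T-≡ a∈Aᵢ)) Fv≼x
  ...   | false = tt

  record RaisedChain (x : Fin N) (i : Fin n) (C : List (Fin N)) : Set where
    field
      chain        : List (Fin N)
      valid        : T (IsChain i chain)
      contains     : C ⊆ chain
      top-bot-or-x : topOf chain ≡ bot ⊎ topOf chain ≡ x
      top-chosen   : T (1 ℕ.<ᵇ length C) → topOf chain ≡ x

  raise : ∀ x i j → T (choiceBelow x i j) → RaisedChain x i (choiceChain i j)
  raise x i zero    _ = record { chain = bot ∷ [] ; valid = botChain i ; contains = ⊆-refl
                               ; top-bot-or-x = inj₁ refl ; top-chosen = λ () }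
  raise x i (suc a) a≼x with InA i a in a∈Aᵢ
  ... | false = record { chain = bot ∷ [] ; valid = botChain i ; contains = ⊆-refl
                       ; top-bot-or-x = inj₁ refl ; top-chosen = λ () }
  ... | true with chain-through (from T-≡ a∈Aᵢ) a≼x
  ...   | D , isD , topD≡x , a∈D = record { chain = D ; valid = isD ; contains = ⊆D
                                          ; top-bot-or-x = inj₂ topD≡x ; top-chosen = λ _ → topD≡x }
    where
    ⊆D : bot ∷ a ∷ [] ⊆ D
    ⊆D (here refl)         = bot∈chain {i} isD
    ⊆D (there (here refl)) = a∈D

  unchosen-top : ∀ i j → ¬ T (chosen i j) → topOf (choiceChain i j) ≡ bot
  unchosen-top i zero    _ = refl
  unchosen-top i (suc a) ¬chosen with InA i a
  ... | true  = ⊥-elim (¬chosen tt)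
  ... | false = refl

  F-≼⇐ : ∀ v x → (∀ i → T (choiceBelow x i (lookup v i))) → F v ≼ x
  F-≼⇐ v x below with FinP.any? (λ i → T? (chosen i (lookup v i)))
  ... | no none = subst (_≼ x) (sym Fv≡bot) (bot-min x)
    where
    Fv≡bot : F v ≡ bot
    Fv≡bot = f-tuple _ _ bot (λ i → inj₁ (unchosen-top i (lookup v i) (λ c → none (i , c)))) (inj₁ refl)
  ... | yes (i , chosenᵢ) = subst (F v ≼_) ft′≡x (f-mono (atomicTuple v) t′ v≤t′)
    where
    raised : ∀ i → RaisedChain x i (choiceChain i (lookup v i))
    raised i = raise x i (lookup v i) (below i)
    open module Raised i = RaisedChain (raised i)
    t′ = tuple chain valid
    ft′≡x : f t′ ≡ x
    ft′≡x = f-tuple chain valid x top-bot-or-x (inj₂ (i , top-chosen i chosenᵢ))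
    v≤t′ : _≤T_ P n blk (atomicTuple v) t′
    v≤t′ = tuple-mono _ chain {λ i → choiceChain-chain i (lookup v i)} {valid} contains

  F-≼-iff : ∀ v x → le (F v) x ≡ allᶠ (λ i → choiceBelow x i (lookup v i))
  F-≼-iff v x = ⇔→≡ {z = true} (mk⇔ (to T-≡ ∘ allᶠ-intro _ ∘ F-≼⇒ v x ∘ from T-≡)
                                    (to T-≡ ∘ F-≼⇐ v x ∘ allᶠ-elim _ ∘ from T-≡))

  weight : ℤ → Fin n → Fin (ℕ.suc N) → ℤ
  weight c i zero    = c
  weight c i (suc a) = if InA i a then - (+ 1) else + 0

  weightProd : ℤ → Choice → ℤ
  weightProd c v = prod (λ i → weight c i (lookup v i))

  admissibleVec : Choice → Bool
  admissibleVec v = allᶠ (λ i → admissible i (lookup v i))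

  support : Choice → ℕ
  support v = countᶠ (λ i → chosen i (lookup v i))

  weight-factor : ∀ c i j → weight c i j ≡ [ admissible i j ]ℤ * (if chosen i j then - (+ 1) else c)
  weight-factor c i zero    = sym (ℤP.*-identityˡ c)
  weight-factor c i (suc a) with InA i a
  ... | true  = refl
  ... | false = refl

  weightProd-factor : ∀ c v →
    weightProd c v ≡ [ admissibleVec v ]ℤ * ((- (+ 1)) ^ support v * c ^ countᶠ (λ i → not (chosen i (lookup v i))))
  weightProd-factor c v = begin
    prod (λ i → weight c i (lookup v i))
      ≡⟨ prod-cong-≗ (λ i → weight-factor c i (lookup v i)) ⟩
    prod (λ i → [ admissible i (lookup v i) ]ℤ * (if chosen i (lookup v i) then - (+ 1) else c))
      ≡⟨ prod-distrib-* (λ i → [ admissible i (lookup v i) ]ℤ) (λ i → if chosen i (lookup v i) then - (+ 1) else c) ⟩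
    prod (λ i → [ admissible i (lookup v i) ]ℤ) * prod (λ i → if chosen i (lookup v i) then - (+ 1) else c)
      ≡⟨ cong₂ _*_ (prod-indicator (λ i → admissible i (lookup v i)))
                   (prod-if (λ i → chosen i (lookup v i)) (- (+ 1)) c) ⟩
    [ admissibleVec v ]ℤ * ((- (+ 1)) ^ support v * c ^ countᶠ (λ i → not (chosen i (lookup v i))))
      ∎
    where open ≡-Reasoning

  atomicTuple-atomic : ∀ v → T (atomic P n blk (atomicTuple v))
  atomicTuple-atomic v = allᶠ-intro _ λ i →
    subst (λ C → T (length C ℕ.≤ᵇ 2)) (sym (comp-atomicTuple v i)) (short i (lookup v i))
    where
    short : ∀ i j → T (length (choiceChain i j) ℕ.≤ᵇ 2)
    short i zero    = tt
    short i (suc a) with InA i a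
    ... | true  = tt
    ... | false = tt

  suppSize-atomicTuple : ∀ v → suppSize P n blk (atomicTuple v) ≡ support v
  suppSize-atomicTuple v = count-cong (λ i → cong (λ C → 1 ℕ.<ᵇ length C) (comp-atomicTuple v i))

  chosenEntry : List (Fin N) → Fin (ℕ.suc N)
  chosenEntry (_ ∷ a ∷ _) = suc a
  chosenEntry _           = zero

  choiceOf : Tuple P n blk → Choice
  choiceOf t = tabulate (λ i → chosenEntry (comp P n blk t i))

  chain-second-inA : ∀ i x a C → T (IsChain i (x ∷ a ∷ C)) → T (InA i a)
  chain-second-inA i x a C isC = atom-inU⇒inA
    (subst (λ y → y ⋖ a) (eqb⇒≡ (proj₁ (to (T-∧ {eqb P x bot}) isC))) (proj₁ (to (T-∧ {covers P x a}) steps)))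
    (proj₁ (to (T-∧ {InU i a}) (proj₂ (to (T-∧ {covers P x a}) steps))))
    where steps = proj₂ (to (T-∧ {eqb P x bot}) isC)

  choiceChain-chosenEntry : ∀ i C → T (IsChain i C) → T (length C ℕ.≤ᵇ 2) → choiceChain i (chosenEntry C) ≡ C
  choiceChain-chosenEntry i (x ∷ []) isC _ = cong (_∷ []) (sym (eqb⇒≡ (proj₁ (to (T-∧ {eqb P x bot}) isC))))
  choiceChain-chosenEntry i (x ∷ a ∷ []) isC _ = trans (choiceChain-inA (chain-second-inA i x a [] isC))
    (cong (_∷ a ∷ []) (sym (eqb⇒≡ (proj₁ (to (T-∧ {eqb P x bot}) isC)))))

  chosenEntry-choiceChain : ∀ i j → T (admissible i j) → chosenEntry (choiceChain i j) ≡ j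
  chosenEntry-choiceChain i zero    _    = refl
  chosenEntry-choiceChain i (suc a) a∈Aᵢ = cong chosenEntry (choiceChain-inA a∈Aᵢ)

  chosenEntry-admissible : ∀ i C → T (IsChain i C) → T (admissible i (chosenEntry C))
  chosenEntry-admissible i (x ∷ [])    _   = tt
  chosenEntry-admissible i (x ∷ a ∷ C) isC = chain-second-inA i x a C isC

  atomicTuple-choiceOf : ∀ t → T (atomic P n blk t) → atomicTuple (choiceOf t) ≡ t
  atomicTuple-choiceOf t t-atomic =
    Σ-≡,≡→≡ (trans (tabulate-cong decode) (tabulate∘lookup (proj₁ t)) , T-irrelevant _ _)
    where
    decode : ∀ i → choiceChain i (lookup (choiceOf t) i) ≡ comp P n blk t i
    decode i = trans (cong (choiceChain i) (lookup∘tabulate _ i))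
                     (choiceChain-chosenEntry i _ (component-chain t i) (allᶠ-elim _ t-atomic i))

  choiceOf-atomicTuple : ∀ v → T (admissibleVec v) → choiceOf (atomicTuple v) ≡ v
  choiceOf-atomicTuple v v-admissible = trans (tabulate-cong encode) (tabulate∘lookup v)
    where
    encode : ∀ i → chosenEntry (comp P n blk (atomicTuple v) i) ≡ lookup v i
    encode i = trans (cong chosenEntry (comp-atomicTuple v i))
                     (chosenEntry-choiceChain i _ (allᶠ-elim _ v-admissible i))

  choiceOf-admissible : ∀ t → T (admissibleVec (choiceOf t))
  choiceOf-admissible t = allᶠ-intro _ λ i →
    subst (T ∘ admissible i) (sym (lookup∘tabulate _ i))
          (chosenEntry-admissible i (comp P n blk t i) (component-chain t i))

  inFibre : Fin N → Choice → Bool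
  inFibre x v = admissibleVec v ∧ eqb P (F v) x

  choice-↔-atomicFiber : ∀ x → Σ Choice (T ∘ inFibre x) ↔ AtomicFiber P n blk f x
  choice-↔-atomicFiber x = mk↔ₛ′
    (λ { (v , v∈) → atomicTuple v , atomicTuple-atomic v , eqb⇒≡ (proj₂ (to (T-∧ {admissibleVec v}) v∈)) })
    (λ { (t , t-atomic , ft≡x) → choiceOf t , from T-∧ (choiceOf-admissible t ,
                                   ≡⇒eqb (trans (cong f (atomicTuple-choiceOf t t-atomic)) ft≡x)) })
    (λ { (t , t-atomic , ft≡x) → Σ-≡,≡→≡ (atomicTuple-choiceOf t t-atomic ,
                                   cong₂ _,_ (T-irrelevant _ _) (Decidable⇒UIP.≡-irrelevant FinP._≟_ _ _)) })
    (λ { (v , v∈) → Σ-≡,≡→≡ (choiceOf-atomicTuple v (proj₁ (to (T-∧ {admissibleVec v}) v∈)) , T-irrelevant _ _) })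

  ν : Fin N → ℤ
  ν y = sumVec n (λ v → if eqb P (F v) y then weightProd (+ 1) v else + 0)

  weight-below-sum : ∀ x i →
    sum (λ j → weight (+ 1) i j * [ choiceBelow x i j ]ℤ) ≡ + 1 - + countᶠ (λ a → InA i a ∧ le a x)
  weight-below-sum x i =
    trans (cong (_+_ (+ 1)) (trans (sum-cong-≗ atomTerm) (sum-if-const (λ a → InA i a ∧ le a x) (- (+ 1)))))
          (1+[-1]*c≡1-c (+ countᶠ (λ a → InA i a ∧ le a x)))
    where
    atomTerm : ∀ a →
      weight (+ 1) i (suc a) * [ choiceBelow x i (suc a) ]ℤ ≡ (if InA i a ∧ le a x then - (+ 1) else + 0)
    atomTerm a with InA i a
    ... | false = refl
    ... | true with le a x
    ...   | true  = refl
    ...   | false = refl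
    1+[-1]*c≡1-c : ∀ c → + 1 + - (+ 1) * c ≡ + 1 - c
    1+[-1]*c≡1-c = solve-∀

  weight-sum : ∀ c i → sum (weight c i) ≡ c - + blockSize P n blk i
  weight-sum c i = trans (cong (_+_ c) (sum-if-const (InA i) (- (+ 1)))) (c+[-1]*k≡c-k c (+ countᶠ (InA i)))
    where
    c+[-1]*k≡c-k : ∀ c k → c + - (+ 1) * k ≡ c - k
    c+[-1]*k≡c-k = solve-∀

  ν-lower-sum : ∀ x →
    sumℤᶠ (λ y → if le y x then ν y else + 0) ≡ prod (λ i → + 1 - + countᶠ (λ a → InA i a ∧ le a x))
  ν-lower-sum x = begin
    sumℤᶠ (λ y → if le y x then ν y else + 0)
      ≡⟨ sumℤᶠ≡sum (λ y → if le y x then ν y else + 0) ⟩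
    sum (λ y → if le y x then ν y else + 0)
      ≡⟨ sum-cong-≗ (λ y → if-then-0 (le y x) (ν y)) ⟩
    sum (λ y → ν y * [ le y x ]ℤ)
      ≡⟨ sum-fibres n F (weightProd (+ 1)) (λ y → [ le y x ]ℤ) ⟩
    sumVec n (λ v → weightProd (+ 1) v * [ le (F v) x ]ℤ)
      ≡⟨ sumVec-cong n (λ v → cong (weightProd (+ 1) v *_) (trans (cong [_]ℤ (F-≼-iff v x))
                                   (sym (prod-indicator (λ i → choiceBelow x i (lookup v i)))))) ⟩
    sumVec n (λ v → weightProd (+ 1) v * prod (λ i → [ choiceBelow x i (lookup v i) ]ℤ))
      ≡⟨ sumVec-cong n (λ v → sym (prod-distrib-* (λ i → weight (+ 1) i (lookup v i))
                                                  (λ i → [ choiceBelow x i (lookup v i) ]ℤ))) ⟩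
    sumVec n (λ v → prod (λ i → weight (+ 1) i (lookup v i) * [ choiceBelow x i (lookup v i) ]ℤ))
      ≡⟨ sumVec-prod n (λ i j → weight (+ 1) i j * [ choiceBelow x i j ]ℤ) ⟩
    prod (λ i → sum (λ j → weight (+ 1) i j * [ choiceBelow x i j ]ℤ))
      ≡⟨ prod-cong-≗ (weight-below-sum x) ⟩
    prod (λ i → + 1 - + countᶠ (λ a → InA i a ∧ le a x))
      ∎
    where open ≡-Reasoning

  -- Hypothesis (2) kills the product for x ≠ 0̂.
  ν-mobius : (∀ x → x ≢ bot → ∃ λ i → countᶠ (λ a → InA i a ∧ le a x) ≡ 1) → IsMobius P ν
  ν-mobius unique-atom x with x FinP.≟ bot | ν-lower-sum x
  ... | yes refl | lower = trans lower (prod-one _ λ i → cong (λ c → + 1 - + c) (count-zero _ (no-atom-below-bot i)))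
    where
    no-atom-below-bot : ∀ i a → ¬ T (InA i a ∧ le a bot)
    no-atom-below-bot i a a∈Aᵢ∧a≼bot =
      atom≢bot (inA⇒atom (proj₁ (to T-∧ a∈Aᵢ∧a≼bot))) (≼-bot (proj₂ (to (T-∧ {InA i a}) a∈Aᵢ∧a≼bot)))
  ... | no x≢bot | lower = let i , one = unique-atom x x≢bot in
    trans lower (prod-zero _ i (cong (λ c → + 1 - + c) one))

  module _ (ρ : Fin N → ℕ)
           (support-ρ : ∀ x t → T (atomic P n blk t) → f t ≡ x → suppSize P n blk t ≡ ρ x) where

    support≡ρ : ∀ v → support v ≡ ρ (F v)
    support≡ρ v = trans (sym (suppSize-atomicTuple v)) (support-ρ (F v) (atomicTuple v) (atomicTuple-atomic v) refl)

    weightProd-one : ∀ v → weightProd (+ 1) v ≡ [ admissibleVec v ]ℤ * (- (+ 1)) ^ ρ (F v)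
    weightProd-one v = trans (weightProd-factor (+ 1) v)
      (cong ([ admissibleVec v ]ℤ *_) (begin
        (- (+ 1)) ^ support v * (+ 1) ^ countᶠ (λ i → not (chosen i (lookup v i)))
          ≡⟨ cong ((- (+ 1)) ^ support v *_) (ℤP.^-zeroˡ (countᶠ (λ i → not (chosen i (lookup v i))))) ⟩
        (- (+ 1)) ^ support v * + 1    ≡⟨ ℤP.*-identityʳ _ ⟩
        (- (+ 1)) ^ support v          ≡⟨ cong ((- (+ 1)) ^_) (support≡ρ v) ⟩
        (- (+ 1)) ^ ρ (F v)            ∎))
      where open ≡-Reasoning

    ν≡signed-count : ∀ x → ν x ≡ (- (+ 1)) ^ ρ x * + countVec n (inFibre x)
    ν≡signed-count x = trans (sumVec-cong n fibreTerm) (sumVec-if-const n (inFibre x) ((- (+ 1)) ^ ρ x))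
      where
      fibreTerm : ∀ v →
        (if eqb P (F v) x then weightProd (+ 1) v else + 0) ≡ (if inFibre x v then (- (+ 1)) ^ ρ x else + 0)
      fibreTerm v rewrite weightProd-one v with eqb P (F v) x in Fv≡x | admissibleVec v
      ... | true  | true  = trans (ℤP.*-identityˡ _) (cong (λ y → (- (+ 1)) ^ ρ y) (eqb⇒≡ (from T-≡ Fv≡x)))
      ... | true  | false = ℤP.*-zeroˡ ((- (+ 1)) ^ ρ (F v))
      ... | false | true  = refl
      ... | false | false = refl

    -- One atom from each block gives an atomic tuple of full support n.
    n≤m : IsOrderedPartition P n blk → ∀ m → (∀ x → ρ x ℕ.≤ m) → n ℕ.≤ m
    n≤m partition m ρ≤m = subst (ℕ._≤ m) support≡n (subst (ℕ._≤ m) (sym (support≡ρ full)) (ρ≤m (F full)))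
      where
      full : Choice
      full = tabulate (λ i → suc (proj₁ (partition i)))
      all-chosen : ∀ i → T (chosen i (lookup full i))
      all-chosen i rewrite lookup∘tabulate (λ i → suc (proj₁ (partition i))) i
                         | choiceChain-inA {i} (proj₂ (partition i)) = tt
      support≡n : support full ≡ n
      support≡n = trans (sym (ℕP.+-identityʳ _))
        (trans (cong (support full ℕ.+_) (sym (count-zero _ (λ i not-chosen → T-not⇒¬T not-chosen (all-chosen i)))))
               (count-complement (λ i → chosen i (lookup full i))))

    module _ (m : ℕ) (n≤m : n ℕ.≤ m) (t : ℤ) where

      weightProd-shift : ∀ v → weightProd (+ 1) v * t ^ (m ∸ ρ (F v)) ≡ t ^ (m ∸ n) * weightProd t v
      weightProd-shift v = begin
        weightProd (+ 1) v * t ^ (m ∸ ρ (F v))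
          ≡⟨ cong₂ _*_ (weightProd-one v) (cong (t ^_) exponent) ⟩
        [ admissibleVec v ]ℤ * σ (ρ (F v)) * t ^ ((m ∸ n) ℕ.+ s′)
          ≡⟨ cong ([ admissibleVec v ]ℤ * σ (ρ (F v)) *_) (ℤP.^-distribˡ-+-* t (m ∸ n) s′) ⟩
        [ admissibleVec v ]ℤ * σ (ρ (F v)) * (t ^ (m ∸ n) * t ^ s′)
          ≡⟨ a*b*[c*d]≡c*[a*[b*d]] [ admissibleVec v ]ℤ (σ (ρ (F v))) (t ^ (m ∸ n)) (t ^ s′) ⟩
        t ^ (m ∸ n) * ([ admissibleVec v ]ℤ * (σ (ρ (F v)) * t ^ s′))
          ≡⟨ cong (λ k → t ^ (m ∸ n) * ([ admissibleVec v ]ℤ * (σ k * t ^ s′))) (support≡ρ v) ⟨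
        t ^ (m ∸ n) * ([ admissibleVec v ]ℤ * (σ (support v) * t ^ s′))
          ≡⟨ cong (t ^ (m ∸ n) *_) (weightProd-factor t v) ⟨
        t ^ (m ∸ n) * weightProd t v
          ∎
        where
        open ≡-Reasoning
        σ : ℕ → ℤ
        σ k = (- (+ 1)) ^ k
        s′ = countᶠ (λ i → not (chosen i (lookup v i)))
        exponent : m ∸ ρ (F v) ≡ (m ∸ n) ℕ.+ s′
        exponent = trans (cong (m ∸_) (sym (support≡ρ v)))
                         (m∸s≡[m∸n]+s′ (count-complement (λ i → chosen i (lookup v i))) n≤m)
        a*b*[c*d]≡c*[a*[b*d]] : ∀ a b c d → a * b * (c * d) ≡ c * (a * (b * d))
        a*b*[c*d]≡c*[a*[b*d]] = solve-∀

      charPoly-factor : ∀ {μ} → (∀ x → μ x ≡ ν x) →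
        charPoly P μ ρ m t ≡ t ^ (m ∸ n) * prodℤᶠ (λ i → t - + blockSize P n blk i)
      charPoly-factor {μ} μ≗ν = begin
        sumℤᶠ (λ x → μ x * t ^ (m ∸ ρ x))
          ≡⟨ sumℤᶠ≡sum (λ x → μ x * t ^ (m ∸ ρ x)) ⟩
        sum (λ x → μ x * t ^ (m ∸ ρ x))
          ≡⟨ sum-cong-≗ (λ x → cong (_* t ^ (m ∸ ρ x)) (μ≗ν x)) ⟩
        sum (λ x → ν x * t ^ (m ∸ ρ x))
          ≡⟨ sum-fibres n F (weightProd (+ 1)) (λ x → t ^ (m ∸ ρ x)) ⟩
        sumVec n (λ v → weightProd (+ 1) v * t ^ (m ∸ ρ (F v)))
          ≡⟨ sumVec-cong n weightProd-shift ⟩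
        sumVec n (λ v → t ^ (m ∸ n) * weightProd t v)
          ≡⟨ *-distribˡ-sumVec n (t ^ (m ∸ n)) (weightProd t) ⟨
        t ^ (m ∸ n) * sumVec n (weightProd t)
          ≡⟨ cong (t ^ (m ∸ n) *_) (sumVec-prod n (weight t)) ⟩
        t ^ (m ∸ n) * prod (λ i → sum (weight t i))
          ≡⟨ cong (t ^ (m ∸ n) *_) (prod-cong-≗ (weight-sum t)) ⟩
        t ^ (m ∸ n) * prod (λ i → t - + blockSize P n blk i)
          ≡⟨ cong (t ^ (m ∸ n) *_) (prodℤᶠ≡prod (λ i → t - + blockSize P n blk i)) ⟨
        t ^ (m ∸ n) * prodℤᶠ (λ i → t - + blockSize P n blk i)
          ∎
        where open ≡-Reasoning

theorem11 : (P : FinPoset) (ρ : Elt P → ℕ) (m : ℕ) → (∀ x → ρ x ≤ m) →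
    (n : ℕ) (blk : Elt P → Fin n) → IsOrderedPartition P n blk →
    (f : Tuple P n blk → Elt P) → IsCompleteTransversal P n blk f →
    (∀ x (t : Tuple P n blk) → T (atomic P n blk t) → f t ≡ x → suppSize P n blk t ≡ ρ x) →
    (∀ x → x ≢ FinPoset.bot P → ∃ (λ i → countᶠ (λ a → inA P n blk i a Data.Bool.∧ FinPoset.le P a x) ≡ 1)) →
    (μ : Elt P → ℤ) → IsMobius P μ →
    QuotientIso P n blk f
    × (∀ x → Σ ℕ (λ k → (AtomicFiber P n blk f x HasSize k) × μ x ≡ (- (+ 1)) ^ ρ x * + k))
    × (∀ t → charPoly P μ ρ m t ≡ t ^ (m ∸ n) * prodℤᶠ (λ i → t - + blockSize P n blk i))
theorem11 P ρ m ρ≤m n blk partition f transversal support-ρ unique-atom μ μ-mobius =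
  quotientIso ,
  (λ x → countVec n (inFibre x) ,
         ↔-trans (countVec-↔ n (inFibre x)) (choice-↔-atomicFiber x) ,
         trans (μ≗ν x) (ν≡signed-count ρ support-ρ x)) ,
  (λ t → charPoly-factor ρ support-ρ m (n≤m ρ support-ρ partition m ρ≤m) t μ≗ν)
  where
  open Transversal P n blk f transversal
  μ≗ν : ∀ x → μ x ≡ ν x
  μ≗ν = Order.mobius-unique P μ-mobius (ν-mobius unique-atom)
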